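{- If $b=(b_1,\dots,b_n)\in\textsc{Partition}'$, then $b$ admits a sound permutation.
   Context: A sequence of integers $b=(b_1,\dots,b_n)$ belongs to $\textsc{Partition}'$ iff: (1) $n$ is even; (2) there exists $B>0$ such that $b_i\ge 2B$ for every $i\in\{1,\dots,n-2\}$, $b_{n-1}=b_n=B$, and $\sum_{i=1}^n b_i=(2n-1)B$; (3) there is an index set $S$ with $\sum_{i\in S}b_i=\sum_{i\notin S}b_i$. A permutation $\pi$ of $\{1,\dots,n\}$ is a sound permutation of $b$ if (i) $\sum_{i=1}^{n}(-1)^i b_{\pi(i)}=0$, and (ii) $\sum_{i=1}^{k}(-1)^{i-1}b_{\pi(k-i+1)}>0$ for all $k<n$. -}

module Defs where

open import Data.Nat as ℕ using (ℕ; zero; suc)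
open import Data.Fin using (Fin; fromℕ<; toℕ)
open import Data.Fin.Permutation using (Permutation′; _⟨$⟩ʳ_)
open import Data.Integer as ℤ using (ℤ; +_; _+_; _*_; -_; _>_; _≤_)
open import Data.Product using (Σ; ∃; _×_; _,_)
open import Data.Bool using (Bool; true; false; if_then_else_)
open import Relation.Binary.PropositionalEquality using (_≡_)
open import Relation.Nullary using (yes; no)

sum1 : ℕ → (ℕ → ℤ) → ℤ
sum1 zero    f = + 0
sum1 (suc k) f = sum1 k f + f (suc k)

sgn : ℕ → ℤ
sgn zero          = + 1
sgn (suc zero)    = - (+ 1)
sgn (suc (suc i)) = sgn i

-- 1-based access: at b i = b_i for 1 ≤ i ≤ n, and 0 otherwise (never used out of range)
at : ∀ {n} → (Fin n → ℤ) → ℕ → ℤ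
at {n} b zero = + 0
at {n} b (suc i) with i ℕ.<? n
... | yes p = b (fromℕ< p)
... | no  _ = + 0

permuted : ∀ {n} → (Fin n → ℤ) → Permutation′ n → Fin n → ℤ
permuted b π j = b (π ⟨$⟩ʳ j)

InPartition′ : (n : ℕ) → (Fin n → ℤ) → Set
InPartition′ n b =
  (Σ ℕ λ m → n ≡ 2 ℕ.* m)
  × (Σ ℤ λ B → (B > + 0)
       × (∀ i → 1 ℕ.≤ i → i ℕ.≤ n ℕ.∸ 2 → (+ 2) * B ≤ at b i)
       × at b (n ℕ.∸ 1) ≡ B
       × at b n ≡ B
       × sum1 n (at b) ≡ (+ (2 ℕ.* n ℕ.∸ 1)) * B)
  × (Σ (Fin n → Bool) λ S →
       sum1 n (λ i → if inS S i then at b i else + 0)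
       ≡ sum1 n (λ i → if inS S i then + 0 else at b i))
  where
  inS : (Fin n → Bool) → ℕ → Bool
  inS S zero = false
  inS S (suc i) with i ℕ.<? n
  ... | yes p = S (fromℕ< p)
  ... | no  _ = false

Sound : (n : ℕ) → (Fin n → ℤ) → Permutation′ n → Set
Sound n b π =
  sum1 n (λ i → sgn i * at (permuted b π) i) ≡ + 0
  × (∀ k → 1 ℕ.≤ k → k ℕ.< n →
       sum1 k (λ i → sgn (i ℕ.∸ 1) * at (permuted b π) (k ℕ.∸ i ℕ.+ 1)) > + 0)

-- Give b_1, …, b_{n-2} weight 2 and the two copies of B weight 1. B times the weight of a side of
-- the partition is at most its sum (2n - 1)B/2, and the weights of the two sides add up to 2n - 2,
-- so each side has weight n - 1; as this is odd, each side holds exactly one copy of B, and n/2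
-- entries. Put one side on the odd positions, starting with its B, and the other on the even
-- positions, ending with its B: the full alternating sum vanishes. On the first n - 1 positions the
-- entries are B, 2B, 2B, … plus an excess x ≥ 0 with Σ x = B and Σ (-1)^i x_i = 0, so every partial
-- alternating sum of x lies in [-B/2, B/2], and every alternating tail sum, being B plus or minus
-- such a partial sum, is at least B/2 > 0.
module Submission where

open import Defs
open import Data.Nat using (ℕ)
open import Data.Fin using (Fin)
open import Data.Fin.Permutation using (Permutation′)
open import Data.Integer using (ℤ)
open import Data.Product using (Σ)

import Algebra.Properties.CommutativeMonoid.Sum as CommutativeMonoidSum
import Algebra.Properties.CommutativeSemigroup as CommutativeSemigroupProperties
open import Data.Bool as Bool using (Bool; true; false; if_then_else_; not)
open import Data.Fin as Fin using (zero; suc; toℕ; fromℕ<; punchIn)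
import Data.Fin.Permutation as Perm
open Perm using (_⟨$⟩ʳ_; _⟨$⟩ˡ_; _∘ₚ_)
import Data.Fin.Permutation.Components as PC
import Data.Fin.Properties as FinP
open import Data.Integer as ℤ using (+_; -[1+_]; _+_; _*_; -_; _-_; _≤_; _<_)
import Data.Integer.Properties as ℤP
open import Algebra.Properties.AbelianGroup ℤP.+-0-abelianGroup using ()
  renaming (∙-cancelˡ to +-cancelˡ; ∙-cancelʳ to +-cancelʳ)
open import Data.Integer.Tactic.RingSolver using (solve-∀)
open import Data.Nat as ℕ using (zero; suc; z≤n; s≤s; _∸_; _≤′_; ≤′-refl; ≤′-step; ⌊_/2⌋; ⌈_/2⌉)
import Data.Nat.Properties as ℕP
open import Data.Product as Prod using (Σ-syntax; ∃; _×_; _,_; proj₁; proj₂)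
open import Data.Sum using (_⊎_; inj₁; inj₂)
open import Function using (_∘_; id)
open import Relation.Binary.Definitions using (DecidableEquality)
open import Relation.Binary.PropositionalEquality
open import Relation.Nullary using (yes; no; does; contradiction)
open import Relation.Nullary.Decidable using (dec-true)

module ℕΣ = CommutativeMonoidSum ℕP.+-0-commutativeMonoid
module ℤΣ = CommutativeMonoidSum ℤP.+-0-commutativeMonoid
module ℕ+ = CommutativeSemigroupProperties ℕP.+-commutativeSemigroup
module ℤ+ = CommutativeSemigroupProperties ℤP.+-commutativeSemigroup

sum1-cong : ∀ k {f g : ℕ → ℤ} → (∀ i → 1 ℕ.≤ i → i ℕ.≤ k → f i ≡ g i) → sum1 k f ≡ sum1 k g
sum1-cong zero    f≡g = refl
sum1-cong (suc k) f≡g =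
  cong₂ _+_ (sum1-cong k λ i 1≤i i≤k → f≡g i 1≤i (ℕP.m≤n⇒m≤1+n i≤k)) (f≡g (suc k) (s≤s z≤n) ℕP.≤-refl)

sum1-monoʳ-≤ : ∀ k {f g : ℕ → ℤ} → (∀ i → 1 ℕ.≤ i → i ℕ.≤ k → f i ≤ g i) → sum1 k f ≤ sum1 k g
sum1-monoʳ-≤ zero    f≤g = ℤP.≤-refl
sum1-monoʳ-≤ (suc k) f≤g =
  ℤP.+-mono-≤ (sum1-monoʳ-≤ k λ i 1≤i i≤k → f≤g i 1≤i (ℕP.m≤n⇒m≤1+n i≤k)) (f≤g (suc k) (s≤s z≤n) ℕP.≤-refl)

sum1-monoˡ-≤ : ∀ {j k} (f : ℕ → ℤ) → j ℕ.≤ k → (∀ i → j ℕ.< i → i ℕ.≤ k → + 0 ≤ f i) → sum1 j f ≤ sum1 k f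
sum1-monoˡ-≤ {j} f j≤k = go (ℕP.≤⇒≤′ j≤k)
  where
  go : ∀ {k} → j ≤′ k → (∀ i → j ℕ.< i → i ℕ.≤ k → + 0 ≤ f i) → sum1 j f ≤ sum1 k f
  go ≤′-refl                 _   = ℤP.≤-refl
  go {suc k} (≤′-step j≤′k) f≥0 =
    ℤP.≤-trans (go j≤′k λ i j<i i≤k → f≥0 i j<i (ℕP.m≤n⇒m≤1+n i≤k))
               (ℤP.i≤i+j (sum1 k f) (f (suc k)) {{ℤ.nonNegative (f≥0 _ (s≤s (ℕP.≤′⇒≤ j≤′k)) ℕP.≤-refl)}})

sum1-distrib-+ : ∀ k (f g : ℕ → ℤ) → sum1 k (λ i → f i + g i) ≡ sum1 k f + sum1 k g
sum1-distrib-+ zero    f g = refl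
sum1-distrib-+ (suc k) f g =
  trans (cong (_+ (f (suc k) + g (suc k))) (sum1-distrib-+ k f g)) (ℤ+.interchange (sum1 k f) (sum1 k g) _ _)

sum1-neg : ∀ k (f : ℕ → ℤ) → sum1 k (λ i → - f i) ≡ - sum1 k f
sum1-neg zero    f = refl
sum1-neg (suc k) f = trans (cong (_+ - f (suc k)) (sum1-neg k f)) (sym (ℤP.neg-distrib-+ (sum1 k f) (f (suc k))))

sum1-distrib-- : ∀ k (f g : ℕ → ℤ) → sum1 k (λ i → f i - g i) ≡ sum1 k f - sum1 k g
sum1-distrib-- k f g = trans (sum1-distrib-+ k f (λ i → - g i)) (cong (_+_ (sum1 k f)) (sum1-neg k g))

sum1-distribˡ-* : ∀ k c (f : ℕ → ℤ) → sum1 k (λ i → c * f i) ≡ c * sum1 k f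
sum1-distribˡ-* zero    c f = sym (ℤP.*-zeroʳ c)
sum1-distribˡ-* (suc k) c f =
  trans (cong (_+ c * f (suc k)) (sum1-distribˡ-* k c f)) (sym (ℤP.*-distribˡ-+ c (sum1 k f) (f (suc k))))

sum1-const : ∀ k c → sum1 k (λ _ → c) ≡ + k * c
sum1-const zero    c = sym (ℤP.*-zeroˡ c)
sum1-const (suc k) c =
  trans (cong (_+ c) (sum1-const k c)) (sym (trans (ℤP.suc-* (+ k) c) (ℤP.+-comm c (+ k * c))))

sum1-suc : ∀ k (f : ℕ → ℤ) → sum1 (suc k) f ≡ f 1 + sum1 k (λ i → f (suc i))
sum1-suc zero    f = ℤP.+-comm (+ 0) (f 1)
sum1-suc (suc k) f = trans (cong (_+ f (suc (suc k))) (sum1-suc k f)) (ℤP.+-assoc (f 1) _ _)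

sgn-suc : ∀ i → sgn (suc i) ≡ - sgn i
sgn-suc zero          = refl
sgn-suc (suc zero)    = refl
sgn-suc (suc (suc i)) = sgn-suc i

sgn-+ : ∀ i j → sgn (i ℕ.+ j) ≡ sgn i * sgn j
sgn-+ zero          j = sym (ℤP.*-identityˡ (sgn j))
sgn-+ (suc zero)    j = trans (sgn-suc j) (sym (ℤP.-1*i≡-i (sgn j)))
sgn-+ (suc (suc i)) j = sgn-+ i j

sgn*sgn : ∀ i → sgn i * sgn i ≡ + 1
sgn*sgn zero          = refl
sgn*sgn (suc zero)    = refl
sgn*sgn (suc (suc i)) = sgn*sgn i

sgn≡±1 : ∀ i → sgn i ≡ + 1 ⊎ sgn i ≡ - + 1
sgn≡±1 zero          = inj₁ refl
sgn≡±1 (suc zero)    = inj₂ refl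
sgn≡±1 (suc (suc i)) = sgn≡±1 i

0≤x+sgn*x : ∀ l {x} → + 0 ≤ x → + 0 ≤ x + sgn l * x
0≤x+sgn*x l {x} x≥0 with sgn l | sgn≡±1 l
... | _ | inj₁ refl = subst (+ 0 ≤_) (cong (_+_ x) (sym (ℤP.*-identityˡ x))) (ℤP.+-mono-≤ x≥0 x≥0)
... | _ | inj₂ refl = ℤP.≤-reflexive (sym (trans (cong (_+_ x) (ℤP.-1*i≡-i x)) (ℤP.+-inverseʳ x)))

alternatingSum : (ℕ → ℤ) → ℕ → ℤ
alternatingSum D k = sum1 k (λ i → sgn i * D i)

-- D k - D (k-1) + D (k-2) - … ± D 1, in the exact form used by Sound.
reverseAlternatingSum : (ℕ → ℤ) → ℕ → ℤ
reverseAlternatingSum D k = sum1 k (λ i → sgn (i ∸ 1) * D (k ∸ i ℕ.+ 1))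

alternatingSum-distrib-- : ∀ k (f g : ℕ → ℤ) →
                           alternatingSum (λ i → f i - g i) k ≡ alternatingSum f k - alternatingSum g k
alternatingSum-distrib-- k f g =
  trans (sum1-cong k λ i _ _ → distrib (sgn i) (f i) (g i)) (sum1-distrib-- k _ _)
  where
  distrib : ∀ s a b → s * (a - b) ≡ s * a - s * b
  distrib = solve-∀

reverseAlternatingSum-suc : ∀ D k → reverseAlternatingSum D (suc k) ≡ D (suc k) - reverseAlternatingSum D k
reverseAlternatingSum-suc D k = begin
  reverseAlternatingSum D (suc k)
    ≡⟨ sum1-suc k _ ⟩
  + 1 * D (k ℕ.+ 1) + sum1 k (λ i → sgn i * D (k ∸ i ℕ.+ 1))
    ≡⟨ cong₂ _+_ (trans (ℤP.*-identityˡ _) (cong D (ℕP.+-comm k 1))) (sum1-cong k flip-sign) ⟩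
  D (suc k) + sum1 k (λ i → - (sgn (i ∸ 1) * D (k ∸ i ℕ.+ 1)))
    ≡⟨ cong (_+_ (D (suc k))) (sum1-neg k _) ⟩
  D (suc k) - reverseAlternatingSum D k
    ∎
  where
  open ≡-Reasoning
  flip-sign : ∀ i → 1 ℕ.≤ i → i ℕ.≤ k → sgn i * D (k ∸ i ℕ.+ 1) ≡ - (sgn (i ∸ 1) * D (k ∸ i ℕ.+ 1))
  flip-sign (suc i) _ _ = trans (cong (_* D (k ∸ suc i ℕ.+ 1)) (sgn-suc i)) (sym (ℤP.neg-distribˡ-* (sgn i) _))

reverseAlternatingSum≡sgn*alternatingSum : ∀ D k → reverseAlternatingSum D k ≡ sgn k * alternatingSum D k
reverseAlternatingSum≡sgn*alternatingSum D zero    = refl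
reverseAlternatingSum≡sgn*alternatingSum D (suc k) = begin
  reverseAlternatingSum D (suc k)          ≡⟨ reverseAlternatingSum-suc D k ⟩
  d - reverseAlternatingSum D k            ≡⟨ cong (_-_ d) (reverseAlternatingSum≡sgn*alternatingSum D k) ⟩
  d - s * a                                ≡⟨ cong (_- s * a) (ℤP.*-identityˡ d) ⟨
  + 1 * d - s * a                          ≡⟨ cong (λ t → t * d - s * a) (sgn*sgn k) ⟨
  s * s * d - s * a                        ≡⟨ regroup s a d ⟩
  - s * (a + - s * d)                      ≡⟨ cong (λ t → t * (a + t * d)) (sgn-suc k) ⟨
  sgn (suc k) * alternatingSum D (suc k)   ∎
  where
  open ≡-Reasoning
  s = sgn k
  a = alternatingSum D k
  d = D (suc k)
  regroup : ∀ s a d → s * s * d - s * a ≡ - s * (a + - s * d)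
  regroup = solve-∀

sgn*2*alternatingSum≤sum1 : ∀ N (x : ℕ → ℤ) → (∀ i → 1 ℕ.≤ i → i ℕ.≤ N → + 0 ≤ x i) →
                            alternatingSum x N ≡ + 0 →
                            ∀ {k} → k ℕ.≤ N → ∀ j → sgn j * (+ 2 * alternatingSum x k) ≤ sum1 N x
sgn*2*alternatingSum≤sum1 N x x≥0 altN≡0 {k} k≤N j = begin
  sgn j * (+ 2 * alternatingSum x k)
    ≡⟨ difference (sum1 k x) (sgn j) (alternatingSum x k) ⟩
  (sum1 k x + sgn j * alternatingSum x k) - (sum1 k x + - sgn j * alternatingSum x k)
    ≡⟨ cong₂ (λ p s → p - (sum1 k x + s * alternatingSum x k)) (P≡ j k) (sgn-suc j) ⟨
  P j k - (sum1 k x + sgn (suc j) * alternatingSum x k)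
    ≡⟨ cong (_-_ (P j k)) (P≡ (suc j) k) ⟨
  P j k - P (suc j) k
    ≤⟨ ℤP.i-j≤i (P j k) (P (suc j) k) {{ℤ.nonNegative (P≥0 (suc j))}} ⟩
  P j k
    ≤⟨ sum1-monoˡ-≤ _ k≤N (λ i k<i → term≥0 j i (ℕP.≤-trans (s≤s z≤n) k<i)) ⟩
  P j N
    ≡⟨ P≡ j N ⟩
  sum1 N x + sgn j * alternatingSum x N
    ≡⟨ cong (λ r → sum1 N x + sgn j * r) altN≡0 ⟩
  sum1 N x + sgn j * + 0
    ≡⟨ trans (cong (_+_ (sum1 N x)) (ℤP.*-zeroʳ (sgn j))) (ℤP.+-identityʳ (sum1 N x)) ⟩
  sum1 N x
    ∎
  where
  open ℤP.≤-Reasoning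
  -- P j k = 2 Σ {x i | i ≤ k, i ≡ j mod 2}: nonnegative and monotone in k.
  P : ℕ → ℕ → ℤ
  P j k = sum1 k (λ i → x i + sgn j * (sgn i * x i))
  P≡ : ∀ j k → P j k ≡ sum1 k x + sgn j * alternatingSum x k
  P≡ j k = trans (sum1-distrib-+ k x _) (cong (_+_ (sum1 k x)) (sum1-distribˡ-* k (sgn j) _))
  term≥0 : ∀ j i → 1 ℕ.≤ i → i ℕ.≤ N → + 0 ≤ x i + sgn j * (sgn i * x i)
  term≥0 j i 1≤i i≤N = subst (λ t → + 0 ≤ x i + t)
    (trans (cong (_* x i) (sgn-+ j i)) (ℤP.*-assoc (sgn j) (sgn i) (x i)))
    (0≤x+sgn*x (j ℕ.+ i) (x≥0 i 1≤i i≤N))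
  P≥0 : ∀ j → + 0 ≤ P j k
  P≥0 j = sum1-monoˡ-≤ _ z≤n (λ i 0<i i≤k → term≥0 j i 0<i (ℕP.≤-trans i≤k k≤N))
  difference : ∀ X s R → s * (+ 2 * R) ≡ (X + s * R) - (X + - s * R)
  difference = solve-∀

-- Termwise lower bound on the interleaved sequence.
baseline : ℤ → ℕ → ℤ
baseline B (suc zero) = B
baseline B _          = + 2 * B

sum1-baseline : ∀ B k → sum1 (suc k) (baseline B) + B ≡ + suc k * (+ 2 * B)
sum1-baseline B zero    = one-term B
  where
  one-term : ∀ B → + 0 + B + B ≡ + 1 * (+ 2 * B)
  one-term = solve-∀
sum1-baseline B (suc k) = begin
  sum1 (suc k) (baseline B) + + 2 * B + B   ≡⟨ ℤ+.xy∙z≈xz∙y (sum1 (suc k) (baseline B)) (+ 2 * B) B ⟩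
  sum1 (suc k) (baseline B) + B + + 2 * B   ≡⟨ cong (_+ + 2 * B) (sum1-baseline B k) ⟩
  + suc k * (+ 2 * B) + + 2 * B             ≡⟨ ℤP.+-comm (+ suc k * (+ 2 * B)) (+ 2 * B) ⟩
  + 2 * B + + suc k * (+ 2 * B)             ≡⟨ ℤP.suc-* (+ suc k) (+ 2 * B) ⟨
  + suc (suc k) * (+ 2 * B)                 ∎
  where open ≡-Reasoning

alternatingSum-baseline : ∀ B k → alternatingSum (baseline B) (suc k) ≡ sgn (suc k) * B
alternatingSum-baseline B zero    = ℤP.+-identityˡ (- + 1 * B)
alternatingSum-baseline B (suc k) = begin
  alternatingSum (baseline B) (suc k) + sgn k * (+ 2 * B)
    ≡⟨ cong (_+ sgn k * (+ 2 * B)) (alternatingSum-baseline B k) ⟩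
  sgn (suc k) * B + sgn k * (+ 2 * B)
    ≡⟨ cong (λ s → s * B + sgn k * (+ 2 * B)) (sgn-suc k) ⟩
  - sgn k * B + sgn k * (+ 2 * B)
    ≡⟨ cancel (sgn k) B ⟩
  sgn k * B
    ∎
  where
  open ≡-Reasoning
  cancel : ∀ s B → - s * B + s * (+ 2 * B) ≡ s * B
  cancel = solve-∀

excess : ℤ → (ℕ → ℤ) → ℕ → ℤ
excess B D i = D i - baseline B i

alternatingSum-excess : ∀ B D k →
  alternatingSum (excess B D) (suc k) ≡ alternatingSum D (suc k) - sgn (suc k) * B
alternatingSum-excess B D k = trans (alternatingSum-distrib-- (suc k) D (baseline B))
                                   (cong (_-_ (alternatingSum D (suc k))) (alternatingSum-baseline B k))

sum1-excess : ∀ B D k → sum1 (suc k) D ≡ + suc k * (+ 2 * B) → sum1 (suc k) (excess B D) ≡ B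
sum1-excess B D k ΣD≡ = begin
  sum1 (suc k) (excess B D)                                    ≡⟨ sum1-distrib-- (suc k) D (baseline B) ⟩
  sum1 (suc k) D - sum1 (suc k) (baseline B)                   ≡⟨ cong (_- sum1 (suc k) (baseline B))
                                                                       (trans ΣD≡ (sym (sum1-baseline B k))) ⟩
  sum1 (suc k) (baseline B) + B - sum1 (suc k) (baseline B)    ≡⟨ plus-minus (sum1 (suc k) (baseline B)) B ⟩
  B                                                            ∎
  where
  open ≡-Reasoning
  plus-minus : ∀ S B → S + B - S ≡ B
  plus-minus = solve-∀

reverseAlternatingSum-excess : ∀ B D k →
  reverseAlternatingSum D (suc k) ≡ B + sgn (suc k) * alternatingSum (excess B D) (suc k)
reverseAlternatingSum-excess B D k = begin
  reverseAlternatingSum D (suc k)   ≡⟨ reverseAlternatingSum≡sgn*alternatingSum D (suc k) ⟩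
  s * A                             ≡⟨ regroup s A B ⟩
  s * s * B + s * (A - s * B)       ≡⟨ cong₂ (λ u r → u + s * r) B≡s*s*B (alternatingSum-excess B D k) ⟨
  B + s * alternatingSum (excess B D) (suc k) ∎
  where
  open ≡-Reasoning
  s = sgn (suc k)
  A = alternatingSum D (suc k)
  B≡s*s*B : B ≡ s * s * B
  B≡s*s*B = sym (trans (cong (_* B) (sgn*sgn (suc k))) (ℤP.*-identityˡ B))
  regroup : ∀ s A B → s * A ≡ s * s * B + s * (A - s * B)
  regroup = solve-∀

reverseAlternatingSum-positive :
  ∀ N {B} (D : ℕ → ℤ) → + 0 < B → D 1 ≡ B → (∀ i → 2 ℕ.≤ i → i ℕ.≤ N → + 2 * B ≤ D i) →
  sum1 N D ≡ + N * (+ 2 * B) → alternatingSum D N ≡ sgn N * B →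
  ∀ k → 1 ℕ.≤ k → k ℕ.≤ N → + 0 < reverseAlternatingSum D k
reverseAlternatingSum-positive (suc M) {B} D B>0 D₁≡B D≥2B ΣD≡ altD≡ (suc k) _ k<N =
  ℤP.*-cancelˡ-<-nonNeg (+ 2) (begin-strict
    + 0                                       <⟨ B>0 ⟩
    B                                         ≡⟨ 2B-B≡B B ⟨
    + 2 * B - B                               ≤⟨ ℤP.+-monoʳ-≤ (+ 2 * B) (ℤP.neg-mono-≤ R-bound) ⟩
    + 2 * B - sgn (suc (suc k)) * (+ 2 * R)   ≡⟨ cong (λ t → + 2 * B - t * (+ 2 * R)) (sgn-suc (suc k)) ⟩
    + 2 * B - - s * (+ 2 * R)                 ≡⟨ double-sum B s R ⟩
    + 2 * (B + s * R)                         ≡⟨ cong (+ 2 *_) (reverseAlternatingSum-excess B D k) ⟨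
    + 2 * reverseAlternatingSum D (suc k)     ∎)
  where
  open ℤP.≤-Reasoning
  N = suc M
  s = sgn (suc k)
  x = excess B D
  R = alternatingSum x (suc k)
  x≥0 : ∀ i → 1 ℕ.≤ i → i ℕ.≤ N → + 0 ≤ x i
  x≥0 (suc zero)    _ _   = ℤP.≤-reflexive (sym (trans (cong (_- B) D₁≡B) (ℤP.+-inverseʳ B)))
  x≥0 (suc (suc i)) _ i≤N = ℤP.i≤j⇒0≤j-i (D≥2B (suc (suc i)) (s≤s (s≤s z≤n)) i≤N)
  altx≡0 : alternatingSum x N ≡ + 0
  altx≡0 = trans (alternatingSum-excess B D M) (trans (cong (_- sgn N * B) altD≡) (ℤP.+-inverseʳ (sgn N * B)))
  R-bound : sgn (suc (suc k)) * (+ 2 * R) ≤ B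
  R-bound = subst (sgn (suc (suc k)) * (+ 2 * R) ≤_) (sum1-excess B D M ΣD≡)
                  (sgn*2*alternatingSum≤sum1 N x x≥0 altx≡0 k<N (suc (suc k)))
  2B-B≡B : ∀ B → + 2 * B - B ≡ B
  2B-B≡B = solve-∀
  double-sum : ∀ B s R → + 2 * B - - s * (+ 2 * R) ≡ + 2 * (B + s * R)
  double-sum = solve-∀

sum1≡∑ : ∀ n (F : ℕ → ℤ) → sum1 n F ≡ ℤΣ.sum (λ (j : Fin n) → F (suc (toℕ j)))
sum1≡∑ zero    F = refl
sum1≡∑ (suc n) F = trans (sum1-suc n F) (cong (_+_ (F 1)) (sum1≡∑ n (F ∘ suc)))

at-suc : ∀ {n} (c : Fin n → ℤ) {i} (i<n : i ℕ.< n) → at c (suc i) ≡ c (fromℕ< i<n)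
at-suc {n} c {i} i<n with i ℕ.<? n
... | yes _   = refl
... | no  i≮n = contradiction i<n i≮n

at-suc-toℕ : ∀ {n} (c : Fin n → ℤ) j → at c (suc (toℕ j)) ≡ c j
at-suc-toℕ c j = trans (at-suc c (FinP.toℕ<n j)) (cong c (FinP.fromℕ<-toℕ j (FinP.toℕ<n j)))

sum1-at : ∀ n (G : ℕ → ℤ → ℤ) (c : Fin n → ℤ) →
          sum1 n (λ i → G i (at c i)) ≡ ℤΣ.sum (λ j → G (suc (toℕ j)) (c j))
sum1-at n G c = trans (sum1≡∑ n _) (ℤΣ.sum-cong-≗ λ j → cong (G (suc (toℕ j))) (at-suc-toℕ c j))

sum1-at-permute : ∀ n (c : Fin n → ℤ) (π : Permutation′ n) → sum1 n (at (permuted c π)) ≡ sum1 n (at c)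
sum1-at-permute n c π = begin
  sum1 n (at (permuted c π))   ≡⟨ sum1-at n (λ _ y → y) (permuted c π) ⟩
  ℤΣ.sum (permuted c π)        ≡⟨ ℤΣ.∑-permute c π ⟨
  ℤΣ.sum c                     ≡⟨ sum1-at n (λ _ y → y) c ⟨
  sum1 n (at c)                ∎
  where open ≡-Reasoning

⟨$⟩ʳ-injective : ∀ {n} (π : Permutation′ n) {p q} → π ⟨$⟩ʳ p ≡ π ⟨$⟩ʳ q → p ≡ q
⟨$⟩ʳ-injective π eq = trans (sym (Perm.inverseˡ π)) (trans (cong (π ⟨$⟩ˡ_) eq) (Perm.inverseˡ π))

module _ {A : Set} (_≟_ : DecidableEquality A) where

  δ : A → A → ℕ
  δ a x = if does (x ≟ a) then 1 else 0

  count : ∀ {n} → A → (Fin n → A) → ℕ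
  count a f = ℕΣ.sum (δ a ∘ f)

  0<count⇒∃ : ∀ {n} a (f : Fin n → A) → 0 ℕ.< count a f → ∃ λ j → f j ≡ a
  0<count⇒∃ {suc n} a f 0<count with f zero ≟ a
  ... | yes f₀≡a = zero , f₀≡a
  ... | no  _    = Prod.map suc id (0<count⇒∃ a (f ∘ suc) 0<count)

  0<count-head : ∀ {n} (g : Fin (suc n) → A) → 0 ℕ.< count (g zero) g
  0<count-head g rewrite dec-true (g zero ≟ g zero) refl = s≤s z≤n

  equal-counts⇒permutation : ∀ {n} (f g : Fin n → A) → (∀ a → count a f ≡ count a g) →
                             Σ[ ρ ∈ Permutation′ n ] (∀ i → f (ρ ⟨$⟩ʳ i) ≡ g i)
  equal-counts⇒permutation {zero}  f g _    = Perm.id , λ ()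
  equal-counts⇒permutation {suc n} f g same = Perm.insert zero e ρ , matches
    where
    e,fe≡g₀ = 0<count⇒∃ (g zero) f (subst (0 ℕ.<_) (sym (same (g zero))) (0<count-head g))
    e = proj₁ e,fe≡g₀
    fe≡g₀ = proj₂ e,fe≡g₀
    same-rest : ∀ a → count a (f ∘ punchIn e) ≡ count a (g ∘ suc)
    same-rest a = ℕP.+-cancelˡ-≡ (δ a (g zero)) _ _ (begin
      δ a (g zero) ℕ.+ count a (f ∘ punchIn e)  ≡⟨ cong (λ y → δ a y ℕ.+ count a (f ∘ punchIn e)) fe≡g₀ ⟨
      δ a (f e) ℕ.+ count a (f ∘ punchIn e)     ≡⟨ ℕΣ.sum-remove (δ a ∘ f) ⟨
      count a f                                 ≡⟨ same a ⟩
      count a g                                 ∎)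
      where open ≡-Reasoning
    rest = equal-counts⇒permutation (f ∘ punchIn e) (g ∘ suc) same-rest
    ρ = proj₁ rest
    matches : ∀ i → f (Perm.insert zero e ρ ⟨$⟩ʳ i) ≡ g i
    matches zero    = fe≡g₀
    matches (suc i) = trans (cong f (Perm.insert-punchIn zero e ρ i)) (proj₂ rest i)

transpose-left : ∀ {n} (q r : Fin n) → PC.transpose q r q ≡ r
transpose-left q r rewrite dec-true (q Fin.≟ q) refl = refl

transpose-other : ∀ {n} {q r p : Fin n} → p ≢ q → p ≢ r → PC.transpose q r p ≡ p
transpose-other {q = q} {r} {p} p≢q p≢r with p Fin.≟ q
... | yes p≡q = contradiction p≡q p≢q
... | no  _   with p Fin.≟ r
...   | yes p≡r = contradiction p≡r p≢r
...   | no  _   = refl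

transpose-preserves : ∀ {A : Set} {n} (g : Fin n → A) {q r} → g q ≡ g r → ∀ p → g (PC.transpose q r p) ≡ g p
transpose-preserves g {q} {r} gq≡gr p with p Fin.≟ q
... | yes refl = sym gq≡gr
... | no  _    with p Fin.≟ r
...   | yes refl = gq≡gr
...   | no  _    = refl

retarget : ∀ {A : Set} {n} {f g : Fin n → A} (ρ : Permutation′ n) → (∀ i → f (ρ ⟨$⟩ʳ i) ≡ g i) →
           ∀ q e → f e ≡ g q →
           Σ[ ρ′ ∈ Permutation′ n ] (∀ i → f (ρ′ ⟨$⟩ʳ i) ≡ g i) × ρ′ ⟨$⟩ʳ q ≡ e
                                    × (∀ p → g p ≢ g q → ρ′ ⟨$⟩ʳ p ≡ ρ ⟨$⟩ʳ p)
retarget {f = f} {g} ρ matches q e fe≡gq = Perm.transpose q r ∘ₚ ρ , matches′ , ρ′q≡e , unchanged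
  where
  r = ρ ⟨$⟩ˡ e
  gq≡gr : g q ≡ g r
  gq≡gr = trans (sym fe≡gq) (trans (cong f (sym (Perm.inverseʳ ρ))) (matches r))
  matches′ : ∀ p → f (ρ ⟨$⟩ʳ PC.transpose q r p) ≡ g p
  matches′ p = trans (matches (PC.transpose q r p)) (transpose-preserves g gq≡gr p)
  ρ′q≡e : ρ ⟨$⟩ʳ PC.transpose q r q ≡ e
  ρ′q≡e = trans (cong (ρ ⟨$⟩ʳ_) (transpose-left q r)) (Perm.inverseʳ ρ)
  unchanged : ∀ p → g p ≢ g q → ρ ⟨$⟩ʳ PC.transpose q r p ≡ ρ ⟨$⟩ʳ p
  unchanged p gp≢gq = cong (ρ ⟨$⟩ʳ_) (transpose-other (λ p≡q → gp≢gq (cong g p≡q))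
                                                      (λ p≡r → gp≢gq (trans (cong g p≡r) (sym gq≡gr))))

equal-counts⇒pinned-permutation :
  ∀ {A : Set} (_≟_ : DecidableEquality A) {n} (f g : Fin n → A) → (∀ a → count _≟_ a f ≡ count _≟_ a g) →
  ∀ {q₁ q₂ e₁ e₂} → f e₁ ≡ g q₁ → f e₂ ≡ g q₂ → g q₂ ≢ g q₁ →
  Σ[ ρ ∈ Permutation′ n ] (∀ i → f (ρ ⟨$⟩ʳ i) ≡ g i) × ρ ⟨$⟩ʳ q₁ ≡ e₁ × ρ ⟨$⟩ʳ q₂ ≡ e₂
equal-counts⇒pinned-permutation _≟_ f g same {q₁} {q₂} {e₁} {e₂} fe₁≡gq₁ fe₂≡gq₂ gq₂≢gq₁ =
  let ρ₀ , matches₀                   = equal-counts⇒permutation _≟_ f g same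
      ρ₁ , matches₁ , ρ₁q₁≡e₁ , _     = retarget ρ₀ matches₀ q₁ e₁ fe₁≡gq₁
      ρ₂ , matches₂ , ρ₂q₂≡e₂ , ρ₂≈ρ₁ = retarget ρ₁ matches₁ q₂ e₂ fe₂≡gq₂
  in ρ₂ , matches₂ , trans (ρ₂≈ρ₁ q₁ (gq₂≢gq₁ ∘ sym)) ρ₁q₁≡e₁ , ρ₂q₂≡e₂

isEven : ℕ → Bool
isEven zero          = true
isEven (suc zero)    = false
isEven (suc (suc i)) = isEven i

isEven-suc : ∀ i → isEven (suc i) ≡ not (isEven i)
isEven-suc zero          = refl
isEven-suc (suc zero)    = refl
isEven-suc (suc (suc i)) = isEven-suc i

isEven-double : ∀ m → isEven (m ℕ.+ m) ≡ true
isEven-double zero    = refl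
isEven-double (suc m) rewrite ℕP.+-suc m m = isEven-double m

sgn-suc≡if-isEven : ∀ i → sgn (suc i) ≡ (if isEven i then - + 1 else + 1)
sgn-suc≡if-isEven zero          = refl
sgn-suc≡if-isEven (suc zero)    = refl
sgn-suc≡if-isEven (suc (suc i)) = sgn-suc≡if-isEven i

count-isEven : ∀ n → count Bool._≟_ true  (λ (p : Fin n) → isEven (toℕ p)) ≡ ⌈ n /2⌉
                   × count Bool._≟_ false (λ (p : Fin n) → isEven (toℕ p)) ≡ ⌊ n /2⌋
count-isEven zero          = refl , refl
count-isEven (suc zero)    = refl , refl
count-isEven (suc (suc n)) = Prod.map (cong suc) (cong suc) (count-isEven n)

count-true+count-false : ∀ {n} (f : Fin n → Bool) → count Bool._≟_ true f ℕ.+ count Bool._≟_ false f ≡ n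
count-true+count-false {zero}  f = refl
count-true+count-false {suc n} f =
  trans (ℕ+.interchange (δ Bool._≟_ true (f zero)) _ (δ Bool._≟_ false (f zero)) _)
        (cong₂ ℕ._+_ (one (f zero)) (count-true+count-false (f ∘ suc)))
  where
  one : ∀ x → δ Bool._≟_ true x ℕ.+ δ Bool._≟_ false x ≡ 1
  one true  = refl
  one false = refl

pos-sum : ∀ {n} (h : Fin n → ℕ) → + ℕΣ.sum h ≡ ℤΣ.sum (λ j → + h j)
pos-sum {zero}  h = refl
pos-sum {suc n} h = trans (ℤP.pos-+ (h zero) (ℕΣ.sum (h ∘ suc))) (cong (_+_ (+ h zero)) (pos-sum (h ∘ suc)))

2*i≢1 : ∀ i → + 2 * i ≢ + 1
2*i≢1 (+ n)    2n≡1 = ℕP.even≢odd n 0 (ℤP.+-injective (trans (ℤP.pos-* 2 n) 2n≡1))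
2*i≢1 -[1+ n ] ()

2*i≢1+2*j : ∀ i j → + 2 * i ≢ + 1 + + 2 * j
2*i≢1+2*j i j eq = 2*i≢1 (i - j) (trans (distrib i j) (trans (cong (_- + 2 * j) eq) (cancel j)))
  where
  distrib : ∀ i j → + 2 * (i - j) ≡ + 2 * i - + 2 * j
  distrib = solve-∀
  cancel : ∀ j → + 1 + + 2 * j - + 2 * j ≡ + 1
  cancel = solve-∀

1+2*i≡1+2*j⇒i≡j : ∀ {i j} → + 1 + + 2 * i ≡ + 1 + + 2 * j → i ≡ j
1+2*i≡1+2*j⇒i≡j {i} {j} eq = ℤP.*-cancelˡ-≡ (+ 2) i j (+-cancelˡ (+ 1) (+ 2 * i) (+ 2 * j) eq)

2*i≤1+2*j⇒i≤j : ∀ {i j} → + 2 * i ≤ + 1 + + 2 * j → i ≤ j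
2*i≤1+2*j⇒i≤j {i} {j} 2i≤1+2j = subst (i ≤_) (ℤP.pred-suc j) (ℤP.i<j⇒i≤pred[j]
  (ℤP.*-cancelˡ-<-nonNeg (+ 2) (ℤP.≤-<-trans 2i≤1+2j (ℤP.suc[i]≤j⇒i<j (ℤP.≤-reflexive (double-suc j))))))
  where
  double-suc : ∀ j → + 1 + (+ 1 + + 2 * j) ≡ + 2 * (+ 1 + j)
  double-suc = solve-∀

balanced-weights : ∀ {B X W V} K → + 0 < B → B * W ≤ X → B * V ≤ X →
                   X + X ≡ B * (+ 1 + + 2 * K) → W + V ≡ + 2 * K → W ≡ K
balanced-weights {B} {X} {W} {V} K B>0 BW≤X BV≤X X+X≡ W+V≡2K = ℤP.≤-antisym (≤K BW≤X) K≤W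
  where
  open ℤP.≤-Reasoning
  ≤K : ∀ {U} → B * U ≤ X → U ≤ K
  ≤K {U} BU≤X = 2*i≤1+2*j⇒i≤j (ℤP.*-cancelˡ-≤-pos (+ 2 * U) (+ 1 + + 2 * K) B {{ℤ.positive B>0}} (begin
    B * (+ 2 * U)       ≡⟨ double B U ⟩
    B * U + B * U       ≤⟨ ℤP.+-mono-≤ BU≤X BU≤X ⟩
    X + X               ≡⟨ X+X≡ ⟩
    B * (+ 1 + + 2 * K) ∎))
    where
    double : ∀ B U → B * (+ 2 * U) ≡ B * U + B * U
    double = solve-∀
  K≤W : K ≤ W
  K≤W = begin
    K           ≡⟨ twice-minus K ⟨
    + 2 * K - K ≤⟨ ℤP.+-monoʳ-≤ (+ 2 * K) (ℤP.neg-mono-≤ (≤K BV≤X)) ⟩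
    + 2 * K - V ≡⟨ cong (_- V) W+V≡2K ⟨
    W + V - V   ≡⟨ plus-minus W V ⟩
    W           ∎
    where
    twice-minus : ∀ K → + 2 * K - K ≡ K
    twice-minus = solve-∀
    plus-minus : ∀ W V → W + V - V ≡ W
    plus-minus = solve-∀

χ : Bool → ℤ
χ true  = + 1
χ false = + 0

χ+χ-not : ∀ a → χ a + χ (not a) ≡ + 1
χ+χ-not true  = refl
χ+χ-not false = refl

χ≡+δ : ∀ x → χ x ≡ + δ Bool._≟_ true x
χ≡+δ true  = refl
χ≡+δ false = refl

odd-weight⇒complementary : ∀ a₁ a₂ c m → + 2 * c + (χ a₁ + χ a₂) ≡ + 1 + + 2 * m → a₂ ≡ not a₁ × c ≡ m
odd-weight⇒complementary true  true  c m eq =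
  contradiction (trans (ℤP.*-distribˡ-+ (+ 2) c (+ 1)) eq) (2*i≢1+2*j (c + + 1) m)
odd-weight⇒complementary false false c m eq =
  contradiction (trans (sym (ℤP.+-identityʳ (+ 2 * c))) eq) (2*i≢1+2*j c m)
odd-weight⇒complementary true  false c m eq = refl , 1+2*i≡1+2*j⇒i≡j (trans (ℤP.+-comm (+ 1) (+ 2 * c)) eq)
odd-weight⇒complementary false true  c m eq = refl , 1+2*i≡1+2*j⇒i≡j (trans (ℤP.+-comm (+ 1) (+ 2 * c)) eq)

*χ≤if : ∀ {x y} a → x ≤ y → x * χ a ≤ (if a then y else + 0)
*χ≤if {x} true  x≤y = subst (_≤ _) (sym (ℤP.*-identityʳ x)) x≤y
*χ≤if {x} false _   = ℤP.≤-reflexive (ℤP.*-zeroʳ x)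

weight≤sum : ∀ k (a : ℕ → ℤ) {B} (ι : ℕ → Bool) → (∀ i → 1 ℕ.≤ i → i ℕ.≤ k → + 2 * B ≤ a i) →
             a (suc k) ≡ B → a (suc (suc k)) ≡ B →
             B * (+ 2 * sum1 k (χ ∘ ι) + (χ (ι (suc k)) + χ (ι (suc (suc k)))))
               ≤ sum1 (suc (suc k)) (λ i → if ι i then a i else + 0)
weight≤sum k a {B} ι a≥2B aₖ₊₁≡B aₖ₊₂≡B = begin
  B * (+ 2 * sum1 k (χ ∘ ι) + (χ a₁ + χ a₂))               ≡⟨ regroup B (sum1 k (χ ∘ ι)) (χ a₁) (χ a₂) ⟩
  + 2 * B * sum1 k (χ ∘ ι) + B * χ a₁ + B * χ a₂           ≡⟨ cong (λ t → t + B * χ a₁ + B * χ a₂)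
                                                                   (sum1-distribˡ-* k (+ 2 * B) (χ ∘ ι)) ⟨
  sum1 k (λ i → + 2 * B * χ (ι i)) + B * χ a₁ + B * χ a₂   ≤⟨ ℤP.+-mono-≤ (ℤP.+-mono-≤
      (sum1-monoʳ-≤ k λ i 1≤i i≤k → *χ≤if (ι i) (a≥2B i 1≤i i≤k))
      (*χ≤if a₁ (ℤP.≤-reflexive (sym aₖ₊₁≡B))))
      (*χ≤if a₂ (ℤP.≤-reflexive (sym aₖ₊₂≡B))) ⟩
  sum1 (suc (suc k)) (λ i → if ι i then a i else + 0)      ∎
  where
  open ℤP.≤-Reasoning
  a₁ = ι (suc k)
  a₂ = ι (suc (suc k))
  regroup : ∀ B c x y → B * (+ 2 * c + (x + y)) ≡ + 2 * B * c + B * x + B * y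
  regroup = solve-∀

if-not : ∀ a (y : ℤ) → (if not a then y else + 0) ≡ (if a then + 0 else y)
if-not true  y = refl
if-not false y = refl

if-split : ∀ x (y : ℤ) → (if x then y else + 0) + (if x then + 0 else y) ≡ y
if-split true  y = ℤP.+-identityʳ y
if-split false y = ℤP.+-identityˡ y

signed : Bool → ℤ → ℤ
signed x y = (if x then - + 1 else + 1) * y

signed-split : ∀ x y → signed x y + (if x then y else + 0) ≡ (if x then + 0 else y)
signed-split true  y = trans (cong (_+ y) (ℤP.-1*i≡-i y)) (ℤP.+-inverseˡ y)
signed-split false y = trans (ℤP.+-identityʳ (+ 1 * y)) (ℤP.*-identityˡ y)

odd-coefficient : ∀ k → + (2 ℕ.* suc (suc k) ∸ 1) ≡ + 1 + + 2 * + suc k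
odd-coefficient k = begin
  + (suc (k ℕ.+ suc (suc (k ℕ.+ 0))))  ≡⟨ cong (+_ ∘ suc) (ℕP.+-suc k (suc (k ℕ.+ 0))) ⟩
  + (1 ℕ.+ 2 ℕ.* suc k)                ≡⟨ ℤP.pos-+ 1 (2 ℕ.* suc k) ⟩
  + 1 + + (2 ℕ.* suc k)                ≡⟨ cong (_+_ (+ 1)) (ℤP.pos-* 2 (suc k)) ⟩
  + 1 + + 2 * + suc k                  ∎
  where open ≡-Reasoning

module SoundPermutation (m : ℕ) (b : Fin (suc (suc (m ℕ.+ m))) → ℤ) {B : ℤ} (B>0 : + 0 < B)
  (b≥2B : ∀ i → 1 ℕ.≤ i → i ℕ.≤ m ℕ.+ m → + 2 * B ≤ at b i)
  (bₖ₊₁≡B : at b (suc (m ℕ.+ m)) ≡ B) (bₙ≡B : at b (suc (suc (m ℕ.+ m))) ≡ B)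
  (Σb : sum1 (suc (suc (m ℕ.+ m))) (at b) ≡ + (2 ℕ.* suc (suc (m ℕ.+ m)) ∸ 1) * B)
  (ι : ℕ → Bool)
  (balanced : sum1 (suc (suc (m ℕ.+ m))) (λ i → if ι i then at b i else + 0)
            ≡ sum1 (suc (suc (m ℕ.+ m))) (λ i → if ι i then + 0 else at b i))
  where

  k n : ℕ
  k = m ℕ.+ m
  n = suc (suc k)

  weight : (ℕ → Bool) → ℤ
  weight κ = + 2 * sum1 k (χ ∘ κ) + (χ (κ (suc k)) + χ (κ n))

  X : ℤ
  X = sum1 n (λ i → if ι i then at b i else + 0)

  X+X : X + X ≡ B * (+ 1 + + 2 * + suc k)
  X+X = begin
    X + X                                              ≡⟨ cong (_+_ X) balanced ⟩
    X + sum1 n (λ i → if ι i then + 0 else at b i)     ≡⟨ sum1-distrib-+ n _ _ ⟨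
    sum1 n (λ i → (if ι i then at b i else + 0) + (if ι i then + 0 else at b i))
                                                       ≡⟨ sum1-cong n (λ i _ _ → if-split (ι i) (at b i)) ⟩
    sum1 n (at b)                                      ≡⟨ Σb ⟩
    + (2 ℕ.* n ∸ 1) * B                                ≡⟨ cong (_* B) (odd-coefficient k) ⟩
    (+ 1 + + 2 * + suc k) * B                          ≡⟨ ℤP.*-comm _ B ⟩
    B * (+ 1 + + 2 * + suc k)                          ∎
    where open ≡-Reasoning

  B*weight≤X : B * weight ι ≤ X
  B*weight≤X = weight≤sum k (at b) ι b≥2B bₖ₊₁≡B bₙ≡B

  B*weight-not≤X : B * weight (not ∘ ι) ≤ X
  B*weight-not≤X = subst (B * weight (not ∘ ι) ≤_)
    (trans (sum1-cong n λ i _ _ → if-not (ι i) (at b i)) (sym balanced))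
    (weight≤sum k (at b) (not ∘ ι) b≥2B bₖ₊₁≡B bₙ≡B)

  weights-sum : weight ι + weight (not ∘ ι) ≡ + 2 * + suc k
  weights-sum = begin
    weight ι + weight (not ∘ ι)
      ≡⟨ regroup (sum1 k (χ ∘ ι)) (sum1 k (χ ∘ not ∘ ι)) (χ a₁) (χ a₂) (χ (not a₁)) (χ (not a₂)) ⟩
    + 2 * (sum1 k (χ ∘ ι) + sum1 k (χ ∘ not ∘ ι)) + ((χ a₁ + χ (not a₁)) + (χ a₂ + χ (not a₂)))
      ≡⟨ cong₂ (λ c d → + 2 * c + d) ordinary-count (cong₂ _+_ (χ+χ-not a₁) (χ+χ-not a₂)) ⟩
    + 2 * + k + (+ 1 + + 1)
      ≡⟨ double-suc (+ k) ⟩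
    + 2 * + suc k
      ∎
    where
    open ≡-Reasoning
    a₁ = ι (suc k)
    a₂ = ι n
    regroup : ∀ c d x₁ x₂ y₁ y₂ →
              (+ 2 * c + (x₁ + x₂)) + (+ 2 * d + (y₁ + y₂)) ≡ + 2 * (c + d) + ((x₁ + y₁) + (x₂ + y₂))
    regroup = solve-∀
    double-suc : ∀ k → + 2 * k + (+ 1 + + 1) ≡ + 2 * (+ 1 + k)
    double-suc = solve-∀
    ordinary-count : sum1 k (χ ∘ ι) + sum1 k (χ ∘ not ∘ ι) ≡ + k
    ordinary-count = begin
      sum1 k (χ ∘ ι) + sum1 k (χ ∘ not ∘ ι)   ≡⟨ sum1-distrib-+ k (χ ∘ ι) (χ ∘ not ∘ ι) ⟨
      sum1 k (λ i → χ (ι i) + χ (not (ι i)))   ≡⟨ sum1-cong k (λ i _ _ → χ+χ-not (ι i)) ⟩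
      sum1 k (λ _ → + 1)                       ≡⟨ sum1-const k (+ 1) ⟩
      + k * + 1                                ≡⟨ ℤP.*-identityʳ (+ k) ⟩
      + k                                      ∎

  one-B-on-each-side : ι n ≡ not (ι (suc k)) × sum1 k (χ ∘ ι) ≡ + m
  one-B-on-each-side = odd-weight⇒complementary (ι (suc k)) (ι n) (sum1 k (χ ∘ ι)) (+ m)
    (trans (balanced-weights (+ suc k) B>0 B*weight≤X B*weight-not≤X X+X weights-sum)
           (cong (_+_ (+ 1)) (trans (ℤP.pos-+ m m) (double (+ m)))))
    where
    double : ∀ m → m + m ≡ + 2 * m
    double = solve-∀

  -- S p: b_{p+1} is in the partition set; target p: position p + 1 is odd (p counts from 0).
  S target : Fin n → Bool
  S j      = ι (suc (toℕ j))
  target p = isEven (toℕ p)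

  count-S-true : count Bool._≟_ true S ≡ suc m
  count-S-true = ℤP.+-injective (begin
    + count Bool._≟_ true S                  ≡⟨ pos-sum (δ Bool._≟_ true ∘ S) ⟩
    ℤΣ.sum (λ j → + δ Bool._≟_ true (S j))   ≡⟨ ℤΣ.sum-cong-≗ (χ≡+δ ∘ S) ⟨
    ℤΣ.sum (χ ∘ S)                           ≡⟨ sum1≡∑ n (χ ∘ ι) ⟨
    sum1 k (χ ∘ ι) + χ a₁ + χ (ι n)          ≡⟨ cong₂ (λ c a₂ → c + χ a₁ + χ a₂)
                                                      (proj₂ one-B-on-each-side) (proj₁ one-B-on-each-side) ⟩
    + m + χ a₁ + χ (not a₁)                  ≡⟨ ℤP.+-assoc (+ m) (χ a₁) (χ (not a₁)) ⟩
    + m + (χ a₁ + χ (not a₁))                ≡⟨ cong (_+_ (+ m)) (χ+χ-not a₁) ⟩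
    + (m ℕ.+ 1)                              ≡⟨ cong +_ (ℕP.+-comm m 1) ⟩
    + suc m                                  ∎)
    where
    open ≡-Reasoning
    a₁ = ι (suc k)

  count-S-false : count Bool._≟_ false S ≡ suc m
  count-S-false = ℕP.+-cancelˡ-≡ (suc m) _ _ (begin
    suc m ℕ.+ count Bool._≟_ false S                    ≡⟨ cong (ℕ._+ count Bool._≟_ false S) count-S-true ⟨
    count Bool._≟_ true S ℕ.+ count Bool._≟_ false S    ≡⟨ count-true+count-false S ⟩
    suc (suc (m ℕ.+ m))                                 ≡⟨ cong suc (ℕP.+-suc m m) ⟨
    suc m ℕ.+ suc m                                     ∎)
    where open ≡-Reasoning

  same-counts : ∀ a → count Bool._≟_ a S ≡ count Bool._≟_ a target
  same-counts true  = trans count-S-true  (sym (trans (proj₁ (count-isEven n)) (cong suc (sym (ℕP.n≡⌈n+n/2⌉ m)))))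
  same-counts false = trans count-S-false (sym (trans (proj₂ (count-isEven n)) (cong suc (sym (ℕP.n≡⌊n+n/2⌋ m)))))

  k<n : k ℕ.< n
  k<n = ℕP.m≤n⇒m≤1+n (ℕP.n<1+n k)

  -- u and v are the positions (counting from 0) of b_{n-1} and b_n; v is also the last position.
  u v : Fin n
  u = fromℕ< k<n
  v = fromℕ< (ℕP.n<1+n (suc k))

  toℕ-v : toℕ v ≡ suc k
  toℕ-v = FinP.toℕ-fromℕ< (ℕP.n<1+n (suc k))

  b-special : ∀ {j} → j ≡ u ⊎ j ≡ v → b j ≡ B
  b-special (inj₁ refl) = trans (sym (at-suc b k<n)) bₖ₊₁≡B
  b-special (inj₂ refl) = trans (sym (at-suc b (ℕP.n<1+n (suc k)))) bₙ≡B

  ordinary-or-special : ∀ j → toℕ j ℕ.< k ⊎ j ≡ u ⊎ j ≡ v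
  ordinary-or-special j with ℕP.m<1+n⇒m<n∨m≡n (FinP.toℕ<n j)
  ... | inj₂ j≡k+1 = inj₂ (inj₂ (FinP.toℕ-injective (trans j≡k+1 (sym toℕ-v))))
  ... | inj₁ j<k+1 with ℕP.m<1+n⇒m<n∨m≡n j<k+1
  ...   | inj₁ j<k = inj₁ j<k
  ...   | inj₂ j≡k = inj₂ (inj₁ (FinP.toℕ-injective (trans j≡k (sym (FinP.toℕ-fromℕ< k<n)))))

  target-v : target v ≡ false
  target-v = trans (cong isEven toℕ-v) (trans (isEven-suc k) (cong not (isEven-double m)))

  S-u : S u ≡ ι (suc k)
  S-u = cong (ι ∘ suc) (FinP.toℕ-fromℕ< k<n)

  S-v : S v ≡ ι n
  S-v = cong (ι ∘ suc) toℕ-v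

  interleave : ∀ {e₁ e₂} → S e₁ ≡ true → S e₂ ≡ false →
               Σ[ π ∈ Permutation′ n ] (∀ p → S (π ⟨$⟩ʳ p) ≡ target p) × π ⟨$⟩ʳ zero ≡ e₁ × π ⟨$⟩ʳ v ≡ e₂
  interleave S-e₁ S-e₂ = equal-counts⇒pinned-permutation Bool._≟_ S target same-counts S-e₁
    (trans S-e₂ (sym target-v)) (λ targetᵥ≡true → contradiction (trans (sym target-v) targetᵥ≡true) λ ())

  EndsAreSpecial : Permutation′ n → Set
  EndsAreSpecial π = (π ⟨$⟩ʳ zero ≡ u × π ⟨$⟩ʳ v ≡ v) ⊎ (π ⟨$⟩ʳ zero ≡ v × π ⟨$⟩ʳ v ≡ u)

  ends-special : ∀ π → EndsAreSpecial π → ∀ {p} → p ≡ zero ⊎ p ≡ v → π ⟨$⟩ʳ p ≡ u ⊎ π ⟨$⟩ʳ p ≡ v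
  ends-special _ (inj₁ (π₀≡u , _)) (inj₁ refl) = inj₁ π₀≡u
  ends-special _ (inj₂ (π₀≡v , _)) (inj₁ refl) = inj₂ π₀≡v
  ends-special _ (inj₁ (_ , πᵥ≡v)) (inj₂ refl) = inj₂ πᵥ≡v
  ends-special _ (inj₂ (_ , πᵥ≡u)) (inj₂ refl) = inj₁ πᵥ≡u

  special-at-ends : ∀ π → EndsAreSpecial π → ∀ p → π ⟨$⟩ʳ p ≡ u ⊎ π ⟨$⟩ʳ p ≡ v → p ≡ zero ⊎ p ≡ v
  special-at-ends π (inj₁ (π₀≡u , _)) p (inj₁ πp≡u) = inj₁ (⟨$⟩ʳ-injective π (trans πp≡u (sym π₀≡u)))
  special-at-ends π (inj₁ (_ , πᵥ≡v)) p (inj₂ πp≡v) = inj₂ (⟨$⟩ʳ-injective π (trans πp≡v (sym πᵥ≡v)))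
  special-at-ends π (inj₂ (_ , πᵥ≡u)) p (inj₁ πp≡u) = inj₂ (⟨$⟩ʳ-injective π (trans πp≡u (sym πᵥ≡u)))
  special-at-ends π (inj₂ (π₀≡v , _)) p (inj₂ πp≡v) = inj₁ (⟨$⟩ʳ-injective π (trans πp≡v (sym π₀≡v)))

  interleaving-from : ∀ a₁ → ι (suc k) ≡ a₁ → ι n ≡ not a₁ →
                      Σ[ π ∈ Permutation′ n ] (∀ p → S (π ⟨$⟩ʳ p) ≡ target p) × EndsAreSpecial π
  interleaving-from true  ι[k+1]≡true  ι[n]≡false =
    let π , matches , π₀≡u , πᵥ≡v = interleave (trans S-u ι[k+1]≡true) (trans S-v ι[n]≡false)
    in  π , matches , inj₁ (π₀≡u , πᵥ≡v)
  interleaving-from false ι[k+1]≡false ι[n]≡true =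
    let π , matches , π₀≡v , πᵥ≡u = interleave (trans S-v ι[n]≡true) (trans S-u ι[k+1]≡false)
    in  π , matches , inj₂ (π₀≡v , πᵥ≡u)

  interleaving : Σ[ π ∈ Permutation′ n ] (∀ p → S (π ⟨$⟩ʳ p) ≡ target p) × EndsAreSpecial π
  interleaving = interleaving-from (ι (suc k)) refl (proj₁ one-B-on-each-side)

  module _ (π : Permutation′ n) (matches : ∀ p → S (π ⟨$⟩ʳ p) ≡ target p) (ends : EndsAreSpecial π) where

    D : ℕ → ℤ
    D = at (permuted b π)

    D₁≡B : D 1 ≡ B
    D₁≡B = trans (at-suc-toℕ (permuted b π) zero) (b-special (ends-special π ends (inj₁ refl)))

    Dₙ≡B : D n ≡ B
    Dₙ≡B = trans (at-suc (permuted b π) (ℕP.n<1+n (suc k))) (b-special (ends-special π ends (inj₂ refl)))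

    D≥2B : ∀ i → 2 ℕ.≤ i → i ℕ.≤ suc k → + 2 * B ≤ D i
    D≥2B (suc zero)    (s≤s ()) _
    D≥2B (suc (suc i)) _ (s≤s i<k) =
      subst (+ 2 * B ≤_) (sym (at-suc (permuted b π) p<n)) (ordinary (ordinary-or-special (π ⟨$⟩ʳ p)))
      where
      p<n : suc i ℕ.< n
      p<n = ℕP.m≤n⇒m≤1+n (s≤s i<k)
      p = fromℕ< p<n
      toℕ-p : toℕ p ≡ suc i
      toℕ-p = FinP.toℕ-fromℕ< p<n
      ordinary : toℕ (π ⟨$⟩ʳ p) ℕ.< k ⊎ π ⟨$⟩ʳ p ≡ u ⊎ π ⟨$⟩ʳ p ≡ v → + 2 * B ≤ b (π ⟨$⟩ʳ p)
      ordinary (inj₁ πp<k) = subst (+ 2 * B ≤_) (at-suc-toℕ b (π ⟨$⟩ʳ p)) (b≥2B _ (s≤s z≤n) πp<k)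
      ordinary (inj₂ πp-special) with special-at-ends π ends p πp-special
      ... | inj₁ p≡0 = contradiction (trans (sym toℕ-p) (cong toℕ p≡0)) λ ()
      ... | inj₂ p≡v = contradiction (trans (sym toℕ-p) (trans (cong toℕ p≡v) toℕ-v)) (ℕP.<⇒≢ (s≤s i<k))

    ΣD : sum1 (suc k) D ≡ + suc k * (+ 2 * B)
    ΣD = begin
      sum1 (suc k) D                  ≡⟨ plus-minus (sum1 (suc k) D) B ⟨
      sum1 (suc k) D + B - B          ≡⟨ cong (λ d → sum1 (suc k) D + d - B) Dₙ≡B ⟨
      sum1 n D - B                    ≡⟨ cong (_- B) (trans (sum1-at-permute n b π) Σb) ⟩
      + (2 ℕ.* n ∸ 1) * B - B         ≡⟨ cong (λ c → c * B - B) (odd-coefficient k) ⟩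
      (+ 1 + + 2 * + suc k) * B - B   ≡⟨ rearrange (+ suc k) B ⟩
      + suc k * (+ 2 * B)             ∎
      where
      open ≡-Reasoning
      plus-minus : ∀ x y → x + y - y ≡ x
      plus-minus = solve-∀
      rearrange : ∀ K B → (+ 1 + + 2 * K) * B - B ≡ K * (+ 2 * B)
      rearrange = solve-∀

    alternatingSum-D≡signed : alternatingSum D n ≡ sum1 n (λ i → signed (ι i) (at b i))
    alternatingSum-D≡signed = begin
      alternatingSum D n                                   ≡⟨ sum1-at n (λ i y → sgn i * y) (permuted b π) ⟩
      ℤΣ.sum (λ p → sgn (suc (toℕ p)) * b (π ⟨$⟩ʳ p))
        ≡⟨ ℤΣ.sum-cong-≗ (λ p → cong (_* b (π ⟨$⟩ʳ p)) (sign p)) ⟩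
      ℤΣ.sum (λ p → signed (S (π ⟨$⟩ʳ p)) (b (π ⟨$⟩ʳ p)))  ≡⟨ ℤΣ.∑-permute (λ j → signed (S j) (b j)) π ⟨
      ℤΣ.sum (λ j → signed (S j) (b j))                    ≡⟨ sum1-at n (signed ∘ ι) b ⟨
      sum1 n (λ i → signed (ι i) (at b i))                 ∎
      where
      open ≡-Reasoning
      sign : ∀ p → sgn (suc (toℕ p)) ≡ (if S (π ⟨$⟩ʳ p) then - + 1 else + 1)
      sign p = trans (sgn-suc≡if-isEven (toℕ p))
                     (cong (λ x → if x then - + 1 else + 1) (sym (matches p)))

    alternatingSum-D≡0 : alternatingSum D n ≡ + 0
    alternatingSum-D≡0 = +-cancelʳ X (alternatingSum D n) (+ 0) (begin
      alternatingSum D n + X                                 ≡⟨ cong (_+ X) alternatingSum-D≡signed ⟩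
      sum1 n (λ i → signed (ι i) (at b i)) + X               ≡⟨ sum1-distrib-+ n _ _ ⟨
      sum1 n (λ i → signed (ι i) (at b i) + (if ι i then at b i else + 0))
                                                             ≡⟨ sum1-cong n (λ i _ _ → signed-split (ι i) (at b i)) ⟩
      sum1 n (λ i → if ι i then + 0 else at b i)             ≡⟨ balanced ⟨
      X                                                      ≡⟨ ℤP.+-identityˡ X ⟨
      + 0 + X                                                ∎)
      where open ≡-Reasoning

    alternatingSum-D-init : alternatingSum D (suc k) ≡ sgn (suc k) * B
    alternatingSum-D-init = begin
      alternatingSum D (suc k)              ≡⟨ plus-minus (alternatingSum D (suc k)) (sgn k * D n) ⟨
      alternatingSum D n - sgn k * D n      ≡⟨ cong (_- sgn k * D n) alternatingSum-D≡0 ⟩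
      + 0 - sgn k * D n                     ≡⟨ zero-minus (sgn k) (D n) ⟩
      - sgn k * D n                         ≡⟨ cong₂ _*_ (sym (sgn-suc k)) Dₙ≡B ⟩
      sgn (suc k) * B                       ∎
      where
      open ≡-Reasoning
      plus-minus : ∀ x y → x + y - y ≡ x
      plus-minus = solve-∀
      zero-minus : ∀ s d → + 0 - s * d ≡ - s * d
      zero-minus = solve-∀

    sound : Sound n b π
    sound = alternatingSum-D≡0 , λ j 1≤j j<n →
      reverseAlternatingSum-positive (suc k) D B>0 D₁≡B D≥2B ΣD alternatingSum-D-init j 1≤j (ℕP.≤-pred j<n)

SoundPermutationExists : ℕ → Set
SoundPermutationExists n = (b : Fin n → ℤ) → InPartition′ n b → Σ (Permutation′ n) (λ π → Sound n b π)

sound-permutation-of-even-length : ∀ m → SoundPermutationExists (suc (suc (m ℕ.+ m)))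
sound-permutation-of-even-length m b (_ , (_ , B>0 , b≥2B , bₖ₊₁≡B , bₙ≡B , Σb) , (_ , balanced)) =
  let π , matches , ends = interleaving in π , sound π matches ends
  where open SoundPermutation m b B>0 b≥2B bₖ₊₁≡B bₙ≡B Σb _ balanced

lemma25 : (n : ℕ) (b : Fin n → ℤ) → InPartition′ n b → Σ (Permutation′ n) (λ π → Sound n b π)
-- For n = 0 the hypothesis b_{n-1} = B reads 0 = B, since at returns 0 out of range.
lemma25 n b ((zero , refl) , (_ , B>0 , _ , b₀≡B , _) , _) = contradiction B>0 (ℤP.<-irrefl b₀≡B)
lemma25 n b h@((suc m , n≡2[1+m]) , _) =
  subst SoundPermutationExists (sym (trans n≡2[1+m] 2[1+m]≡2+m+m)) (sound-permutation-of-even-length m) b h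
  where
  2[1+m]≡2+m+m : 2 ℕ.* suc m ≡ suc (suc (m ℕ.+ m))
  2[1+m]≡2+m+m = cong suc (trans (ℕP.+-suc m (m ℕ.+ 0)) (cong (ℕ.suc ∘ (m ℕ.+_)) (ℕP.+-identityʳ m)))
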